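{- Let $k,\ell$ be integers and let $I=(p,\varpi,\rho_0,\dots,\rho_q)$ be a general interpretation scheme of $\lambda$-structures in $\beta_{k,\ell}$-structures defined by quantifier-free formulas, such that there exists an integer $N$ with the property that for every $\mathbf B\in\mathcal B_{k,\ell}$ and every $(v_1,\dots,v_p)\in B^p$, the $\varpi$-equivalence class of $(v_1,\dots,v_p)$ has cardinality at most $N$. Then there exists a quantifier-free formula $\hat\rho_0$ with $p$ free variables such that the (ordinary) QF-interpretation scheme $\hat I=(p,\hat\rho_0,\rho_1,\dots,\rho_q)$ of $\lambda$-structures in $\beta_{k,\ell}$-structures satisfies: for every $\mathbf B\in\mathcal B_{k,\ell}$, the $\lambda$-structures $I(\mathbf B)$ and $\hat I(\mathbf B)$ are isomorphic.
   Context: A signature is a finite set of relation symbols with arities; a structure has a finite domain and relations of the prescribed arities; formulas are first-order with equality. Ordinary interpretation scheme: if $\lambda$ has symbols $R_1,\dots,R_q$ of arities $r_1,\dots,r_q$, $\hat I=(p,\rho_0,\dots,\rho_q)$ with $\rho_0$ a $\kappa$-formula with $p$ free variables and $\rho_i$ a $\kappa$-formula with $pr_i$ free variables; $\hat I(\mathbf A)$ has domain $\{\mathbf v\in A^p:\mathbf A\models\rho_0(\mathbf v)\}$ and $R_i(\mathbf v_1,\dots,\mathbf v_{r_i})$ holds iff $\mathbf A\models\rho_i(\mathbf v_1,\dots,\mathbf v_{r_i})$; QF means all formulas quantifier-free. General interpretation scheme $I=(p,\varpi,\rho_0,\dots,\rho_q)$: additionally $\varpi$ is a $\kappa$-formula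 with $2p$ free variables defining an equivalence relation on $p$-tuples compatible with the $\rho_i$ (i.e. $\bigwedge_{j=1}^{r_i}\varpi(\mathbf x_j,\mathbf y_j)$ entails $\rho_i(\mathbf x_1,\dots,\mathbf x_{r_i})\leftrightarrow\rho_i(\mathbf y_1,\dots,\mathbf y_{r_i})$); $I(\mathbf A)$ has as domain the $\varpi$-classes $[\mathbf x]$ of tuples $\mathbf x\in A^p$ with $\mathbf A\models\rho_0(\mathbf x)$, and $R_i([\mathbf x_1],\dots,[\mathbf x_{r_i}])$ holds iff $\mathbf A\models\rho_i(\mathbf x_1,\dots,\mathbf x_{r_i})$. Strong sum $\mathbf A\oplus\mathbf B$: signature the disjoint union of signatures, domain $A\sqcup B$, each relation holding exactly on the tuples of its own summand on which it holds there. $\mathbf E$: one-element domain with a unary relation true on it. $\mathbf T_M$: domain $\{1,\dots,M\}$ with binary $S$, $S(i,j)\iff i<j$, and unary $U$ true everywhere. $\mathcal B_{k,\ell}$ is the class of structures $\mathbf E\oplus\dots\oplus\mathbf E\oplus\mathbf T_{N_1}\oplus\dots\oplus\mathbf T_{N_k}$ ($\ell$ copies of $\mathbf E$, arbitrary $N_1,\dots,N_k$), and $\beta_{k,\ell}$ is their signature, with relations $U^E_1,\dots,U^E_\ell$ (marking the copies of $\mathbf E$), $U^T_1,\dots,U^T_k$ (marking the tournaments) and $S_1,\dots,S_k$ (the orders of the tournaments). -}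

module Defs where

open import Data.Nat using (ℕ; suc)
open import Data.Fin using (Fin; zero; suc; _<_)
open import Data.Vec using (Vec; lookup)
open import Data.Product using (Σ; _×_; _,_; proj₁)
open import Data.Sum using (_⊎_; inj₁; inj₂)
open import Data.Empty using (⊥)
open import Data.Unit using (⊤)
open import Relation.Nullary using (¬_)
open import Relation.Binary.PropositionalEquality using (_≡_)
open import Function using (_∘_; _⇔_)
open import Function.Definitions using (Injective)

record Sig : Set₁ where
  field
    Sym : Set
    ar  : Sym → ℕ
open Sig public

finSig : (q : ℕ) → (Fin q → ℕ) → Sig
finSig q a = record { Sym = Fin q ; ar = a }

record Structure (σ : Sig) : Set₁ where
  field
    Carrier : Set
    rel     : (s : Sym σ) → (Fin (ar σ s) → Carrier) → Set
open Structure public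

data QF (σ : Sig) (V : Set) : Set where
  true false : QF σ V
  _≐_  : V → V → QF σ V
  R    : (s : Sym σ) → (Fin (ar σ s) → V) → QF σ V
  ¬'_  : QF σ V → QF σ V
  _∧'_ : QF σ V → QF σ V → QF σ V
  _∨'_ : QF σ V → QF σ V → QF σ V

⟦_⟧ : ∀ {σ V} → QF σ V → (M : Structure σ) → (V → Carrier M) → Set
⟦ true ⟧    M a = ⊤
⟦ false ⟧   M a = ⊥
⟦ x ≐ y ⟧   M a = a x ≡ a y
⟦ R s xs ⟧  M a = rel M s (a ∘ xs)
⟦ ¬' φ ⟧    M a = ¬ ⟦ φ ⟧ M a
⟦ φ ∧' ψ ⟧  M a = ⟦ φ ⟧ M a × ⟦ ψ ⟧ M a
⟦ φ ∨' ψ ⟧  M a = ⟦ φ ⟧ M a ⊎ ⟦ ψ ⟧ M a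

-- Structures whose domain is presented as a setoid (domain = classes of
-- the equivalence _≈_), and isomorphism of such structures.

record SetoidStructure (σ : Sig) : Set₁ where
  field
    Carrier : Set
    _≈_     : Carrier → Carrier → Set
    rel     : (s : Sym σ) → (Fin (ar σ s) → Carrier) → Set

record _≅_ {σ : Sig} (A B : SetoidStructure σ) : Set where
  private
    module A = SetoidStructure A
    module B = SetoidStructure B
  field
    to      : A.Carrier → B.Carrier
    to-cong : ∀ {x y} → x A.≈ y → to x B.≈ to y
    to-inj  : ∀ {x y} → to x B.≈ to y → x A.≈ y
    to-surj : ∀ b → Σ A.Carrier (λ a → to a B.≈ b)
    to-rel  : ∀ s (u : Fin (ar σ s) → A.Carrier) → A.rel s u ⇔ B.rel s (to ∘ u)

-- variables of ρ_i: (j , c) is the c-th coordinate of the j-th p-tuple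
tupAssign : ∀ {C : Set} {r p : ℕ} → (Fin r → Vec C p) → Fin r × Fin p → C
tupAssign u (j , c) = lookup (u j) c

pairAssign : ∀ {C : Set} {p : ℕ} → Vec C p → Vec C p → Fin 2 × Fin p → C
pairAssign x y (zero , c)  = lookup x c
pairAssign x y (suc _ , c) = lookup y c

record Scheme (κ λ' : Sig) : Set where
  field
    p  : ℕ
    ρ₀ : QF κ (Fin p)
    ρ  : (s : Sym λ') → QF κ (Fin (ar λ' s) × Fin p)

record GScheme (κ λ' : Sig) : Set where
  field
    p  : ℕ
    ϖ  : QF κ (Fin 2 × Fin p)
    ρ₀ : QF κ (Fin p)
    ρ  : (s : Sym λ') → QF κ (Fin (ar λ' s) × Fin p)

⟦_⟧ˢ : ∀ {κ λ'} → Scheme κ λ' → Structure κ → SetoidStructure λ'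
⟦ I ⟧ˢ A = record
  { Carrier = Σ (Vec (Carrier A) p) (λ x → ⟦ ρ₀ ⟧ A (lookup x))
  ; _≈_     = λ x y → proj₁ x ≡ proj₁ y
  ; rel     = λ s u → ⟦ ρ s ⟧ A (tupAssign (proj₁ ∘ u))
  }
  where open Scheme I

⟦_⟧ᵍ : ∀ {κ λ'} → GScheme κ λ' → Structure κ → SetoidStructure λ'
⟦ I ⟧ᵍ A = record
  { Carrier = Σ (Vec (Carrier A) p) (λ x → ⟦ ρ₀ ⟧ A (lookup x))
  ; _≈_     = λ x y → ⟦ ϖ ⟧ A (pairAssign (proj₁ x) (proj₁ y))
  ; rel     = λ s u → ⟦ ρ s ⟧ A (tupAssign (proj₁ ∘ u))
  }
  where open GScheme I

record WellDefinedOn {κ λ'} (I : GScheme κ λ') (A : Structure κ) : Set where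
  open GScheme I
  Eq : Vec (Carrier A) p → Vec (Carrier A) p → Set
  Eq x y = ⟦ ϖ ⟧ A (pairAssign x y)
  field
    ϖ-refl  : ∀ x → Eq x x
    ϖ-sym   : ∀ x y → Eq x y → Eq y x
    ϖ-trans : ∀ x y z → Eq x y → Eq y z → Eq x z
    ρ-compat : ∀ s (u v : Fin (ar λ' s) → Vec (Carrier A) p) →
               (∀ j → Eq (u j) (v j)) →
               ⟦ ρ s ⟧ A (tupAssign u) ⇔ ⟦ ρ s ⟧ A (tupAssign v)

ClassSizeAtMost : ∀ {κ λ'} (I : GScheme κ λ') (A : Structure κ) →
                  ℕ → Vec (Carrier A) (GScheme.p I) → Set
ClassSizeAtMost I A N v =
  ¬ Σ (Fin (suc N) → Vec (Carrier A) p) (λ g →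
      Injective _≡_ _≡_ g × (∀ j → ⟦ ϖ ⟧ A (pairAssign v (g j))))
  where open GScheme I

data BSym (k ℓ : ℕ) : Set where
  UE : Fin ℓ → BSym k ℓ
  UT : Fin k → BSym k ℓ
  S  : Fin k → BSym k ℓ

βar : ∀ {k ℓ} → BSym k ℓ → ℕ
βar (UE _) = 1
βar (UT _) = 1
βar (S _)  = 2

β : ℕ → ℕ → Sig
β k ℓ = record { Sym = BSym k ℓ ; ar = βar }

-- E ⊕ … ⊕ E (ℓ copies) ⊕ T_{N 0} ⊕ … ⊕ T_{N (k-1)};
-- the domain {1,…,M} of T_M is represented by Fin M (same order).
BDom : (k ℓ : ℕ) → (Fin k → ℕ) → Set
BDom k ℓ N = Fin ℓ ⊎ Σ (Fin k) (λ i → Fin (N i))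

Brel : ∀ {k ℓ} (N : Fin k → ℕ) (s : BSym k ℓ) → (Fin (βar s) → BDom k ℓ N) → Set
Brel N (UE e) u = u zero ≡ inj₁ e
Brel N (UT i) u = Σ (Fin (N i)) (λ a → u zero ≡ inj₂ (i , a))
Brel N (S i)  u = Σ (Fin (N i)) (λ a → Σ (Fin (N i)) (λ b →
                    u zero ≡ inj₂ (i , a) × u (suc zero) ≡ inj₂ (i , b) × a < b))

𝔹 : (k ℓ : ℕ) → (Fin k → ℕ) → Structure (β k ℓ)
𝔹 k ℓ N = record { Carrier = BDom k ℓ N ; rel = Brel N }

withDomain : ∀ {κ λ'} (I : GScheme κ λ') → QF κ (Fin (GScheme.p I)) → Scheme κ λ'
withDomain I ρ̂₀ = record { p = GScheme.p I ; ρ₀ = ρ̂₀ ; ρ = GScheme.ρ I }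

-- If ϖ(x, y) holds in B ∈ 𝓑_{k,ℓ}, every coordinate of y is the point of a copy of E or a
-- coordinate of x. Otherwise y has a tournament point z outside x; stretching each tournament
-- by the factor M + 1 and letting z alone range over the M + 1 new points replacing it gives,
-- since embeddings preserve quantifier-free formulas, M + 1 distinct tuples ϖ-equivalent to a
-- single one, against the bound M on class sizes. So whether x is lexicographically least in
-- its class (for the order E_1 < … < E_ℓ < T_1 < … < T_k) only depends on finitely many
-- candidates built from x and the points of E, and is quantifier-free definable; the least
-- elements form a transversal of ϖ, which gives the isomorphism.

module Submission where

open import Defs
open import Data.Nat as ℕ using (ℕ; zero; suc; _+_; _*_)
open import Data.Fin as Fin using (Fin; zero; suc; toℕ; combine; join; _<_)
import Data.Fin.Properties as Finₚ
import Data.Fin.Induction as Finᵢ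
import Data.Nat.Induction as ℕᵢ
open import Data.List using (List; []; _∷_; allFin; cartesianProductWith; _++_)
  renaming (map to mapₗ)
open import Data.List.Membership.Propositional using (_∈_; lose)
open import Data.List.Membership.Propositional.Properties
  using (∈-allFin; ∈-map⁺; ∈-++⁺ˡ; ∈-++⁺ʳ; ∈-cartesianProductWith⁺)
open import Data.List.Relation.Unary.Any using (Any; here; satisfied; toSum; fromSum)
open import Data.Vec using (Vec; []; _∷_; lookup; map; tabulate)
open import Data.Vec.Properties using (lookup-map; tabulate∘lookup; tabulate-∘; tabulate-cong)
open import Data.Vec.Relation.Binary.Lex.Strict using (Lex-<; this; next; <-wellFounded)
open import Data.Vec.Relation.Binary.Lex.Core using (P⇔[]<[]; ∷<∷-⇔)
open import Data.Product using (Σ; ∃; _×_; _,_; proj₁; proj₂)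
open import Data.Product.Function.NonDependent.Propositional using (_×-⇔_)
open import Data.Product.Relation.Binary.Lex.Strict using (×-Lex; ×-wellFounded)
import Data.Product.Properties as Σₚ
open import Data.Sum using (_⊎_; inj₁; inj₂; [_,_])
open import Data.Sum.Function.Propositional using (_⊎-⇔_)
import Data.Sum.Properties as ⊎ₚ
open import Data.Bool using (if_then_else_)
open import Data.Empty using (⊥-elim)
open import Data.Unit using (tt)
open import Function using (_∘_; id; _⇔_; mk⇔; Equivalence)
open import Function.Definitions using (Injective)
open import Function.Properties.Equivalence using () renaming (refl to ⇔-refl; trans to ⇔-trans)
open import Function.Related.TypeIsomorphisms using (¬-cong-⇔)
open import Induction.WellFounded using (WellFounded; Acc; acc)
import Induction.WellFounded as WF
import Relation.Binary.Construct.On as On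
open import Relation.Binary.Definitions using (DecidableEquality; tri<; tri≈; tri>)
open import Relation.Binary.PropositionalEquality
  using (_≡_; refl; sym; trans; cong; subst; subst₂; module ≡-Reasoning)
open import Relation.Nullary using (¬_; Dec; yes; no; ¬?; _×-dec_; _⊎-dec_)
open import Relation.Nullary.Decidable using (map′; does; dec-true; dec-false)

open Equivalence using (to; from)

private
  variable
    σ : Sig
    V W : Set

rename : (V → W) → QF σ V → QF σ W
rename f true     = true
rename f false    = false
rename f (x ≐ y)  = f x ≐ f y
rename f (R s xs) = R s (f ∘ xs)
rename f (¬' φ)   = ¬' rename f φ
rename f (φ ∧' ψ) = rename f φ ∧' rename f ψ
rename f (φ ∨' ψ) = rename f φ ∨' rename f ψ

rename-⇔ : ∀ (f : V → W) (φ : QF σ V) {M : Structure σ} {a : W → Carrier M} →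
           ⟦ rename f φ ⟧ M a ⇔ ⟦ φ ⟧ M (a ∘ f)
rename-⇔ f true     = ⇔-refl
rename-⇔ f false    = ⇔-refl
rename-⇔ f (x ≐ y)  = ⇔-refl
rename-⇔ f (R s xs) = ⇔-refl
rename-⇔ f (¬' φ)   = ¬-cong-⇔ (rename-⇔ f φ)
rename-⇔ f (φ ∧' ψ) = rename-⇔ f φ ×-⇔ rename-⇔ f ψ
rename-⇔ f (φ ∨' ψ) = rename-⇔ f φ ⊎-⇔ rename-⇔ f ψ

⌜_⌝ : {P : Set} → Dec P → QF σ V
⌜ yes _ ⌝ = true
⌜ no _ ⌝  = false

⌜⌝-⇔ : ∀ {P : Set} (P? : Dec P) {M : Structure σ} {a : V → Carrier M} →
       ⟦ ⌜ P? ⌝ ⟧ M a ⇔ P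
⌜⌝-⇔ (yes p) = mk⇔ (λ _ → p) (λ _ → tt)
⌜⌝-⇔ (no ¬p) = mk⇔ (λ ()) ¬p

record Enumeration (A : Set) : Set where
  field
    elements : List A
    complete : ∀ x → x ∈ elements
open Enumeration

finite : ∀ n → Enumeration (Fin n)
finite n = record { elements = allFin n ; complete = ∈-allFin }

_⊎ᵉ_ : ∀ {A B} → Enumeration A → Enumeration B → Enumeration (A ⊎ B)
EA ⊎ᵉ EB = record
  { elements = mapₗ inj₁ (elements EA) ++ mapₗ inj₂ (elements EB)
  ; complete = [ (λ x → ∈-++⁺ˡ (∈-map⁺ inj₁ (complete EA x)))
               , (λ y → ∈-++⁺ʳ _ (∈-map⁺ inj₂ (complete EB y))) ]
  }

vecᵉ : ∀ {A} → Enumeration A → ∀ n → Enumeration (Vec A n)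
vecᵉ EA zero    = record { elements = [] ∷ [] ; complete = λ { [] → here refl } }
vecᵉ EA (suc n) = record
  { elements = cartesianProductWith _∷_ (elements EA) (elements (vecᵉ EA n))
  ; complete = λ { (x ∷ xs) → ∈-cartesianProductWith⁺ _∷_ (complete EA x) (complete (vecᵉ EA n) xs) }
  }

⋁ : ∀ {I : Set} → List I → (I → QF σ V) → QF σ V
⋁ []       φ = false
⋁ (i ∷ is) φ = φ i ∨' ⋁ is φ

⋁-Any : ∀ {I : Set} (is : List I) (φ : I → QF σ V) {M : Structure σ} {a : V → Carrier M} →
        ⟦ ⋁ is φ ⟧ M a ⇔ Any (λ i → ⟦ φ i ⟧ M a) is
⋁-Any []       φ = mk⇔ (λ ()) (λ ())
⋁-Any (i ∷ is) φ = ⇔-trans (⇔-refl ⊎-⇔ ⋁-Any is φ) (mk⇔ fromSum toSum)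

⋁-⇔ : ∀ {I : Set} (E : Enumeration I) (φ : I → QF σ V) {M : Structure σ} {a : V → Carrier M} →
      ⟦ ⋁ (elements E) φ ⟧ M a ⇔ ∃ λ i → ⟦ φ i ⟧ M a
⋁-⇔ E φ = ⇔-trans (⋁-Any (elements E) φ) (mk⇔ satisfied (λ (i , φi) → lose (complete E i) φi))

record Embedding (M M' : Structure σ) : Set where
  field
    embed     : Carrier M → Carrier M'
    injective : Injective _≡_ _≡_ embed
    rel-⇔     : ∀ s {u v} → (∀ j → embed (u j) ≡ v j) → rel M s u ⇔ rel M' s v
open Embedding

embedding-⇔ : ∀ {M M' : Structure σ} (h : Embedding M M') (φ : QF σ V)
              {a : V → Carrier M} {b : V → Carrier M'} →
              (∀ x → embed h (a x) ≡ b x) → ⟦ φ ⟧ M a ⇔ ⟦ φ ⟧ M' b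
embedding-⇔ h true     ha≡b = ⇔-refl
embedding-⇔ h false    ha≡b = ⇔-refl
embedding-⇔ h (x ≐ y)  ha≡b = mk⇔
  (λ ax≡ay → trans (sym (ha≡b x)) (trans (cong (embed h) ax≡ay) (ha≡b y)))
  (λ bx≡by → injective h (trans (ha≡b x) (trans bx≡by (sym (ha≡b y)))))
embedding-⇔ h (R s xs) ha≡b = rel-⇔ h s (ha≡b ∘ xs)
embedding-⇔ h (¬' φ)   ha≡b = ¬-cong-⇔ (embedding-⇔ h φ ha≡b)
embedding-⇔ h (φ ∧' ψ) ha≡b = embedding-⇔ h φ ha≡b ×-⇔ embedding-⇔ h ψ ha≡b
embedding-⇔ h (φ ∨' ψ) ha≡b = embedding-⇔ h φ ha≡b ⊎-⇔ embedding-⇔ h ψ ha≡b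

module _ {M : Structure σ} (_≟_ : DecidableEquality (Carrier M))
         (rel? : ∀ s u → Dec (rel M s u)) where

  ⟦⟧-dec : (φ : QF σ V) (a : V → Carrier M) → Dec (⟦ φ ⟧ M a)
  ⟦⟧-dec true     a = yes tt
  ⟦⟧-dec false    a = no λ ()
  ⟦⟧-dec (x ≐ y)  a = a x ≟ a y
  ⟦⟧-dec (R s xs) a = rel? s (a ∘ xs)
  ⟦⟧-dec (¬' φ)   a = ¬? (⟦⟧-dec φ a)
  ⟦⟧-dec (φ ∧' ψ) a = ⟦⟧-dec φ a ×-dec ⟦⟧-dec ψ a
  ⟦⟧-dec (φ ∨' ψ) a = ⟦⟧-dec φ a ⊎-dec ⟦⟧-dec ψ a

record IsTransversal {κ λ' : Sig} (I : GScheme κ λ') (A : Structure κ)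
                     (ρ̂₀ : QF κ (Fin (GScheme.p I))) : Set where
  open GScheme I
  field
    ρ̂₀⇒ρ₀  : ∀ x → ⟦ ρ̂₀ ⟧ A (lookup x) → ⟦ ρ₀ ⟧ A (lookup x)
    meets  : ∀ x → ⟦ ρ₀ ⟧ A (lookup x) →
             ∃ λ y → ⟦ ρ̂₀ ⟧ A (lookup y) × ⟦ ϖ ⟧ A (pairAssign x y)
    unique : ∀ x y → ⟦ ρ̂₀ ⟧ A (lookup x) → ⟦ ρ̂₀ ⟧ A (lookup y) →
             ⟦ ϖ ⟧ A (pairAssign x y) → x ≡ y

transversal-≅ : ∀ {κ λ'} {I : GScheme κ λ'} {A : Structure κ} {ρ̂₀} →
                WellDefinedOn I A → IsTransversal I A ρ̂₀ →
                ⟦ I ⟧ᵍ A ≅ ⟦ withDomain I ρ̂₀ ⟧ˢ A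
transversal-≅ {I = I} {A} {ρ̂₀} wd T = record
  { to      = representative
  ; to-cong = λ {x} {y} x∼y → unique _ _ (chosen x) (chosen y)
                (ϖ-trans _ _ _ (ϖ-sym _ _ (class x)) (ϖ-trans _ _ _ x∼y (class y)))
  ; to-inj  = λ {x} {y} same → ϖ-trans _ _ _ (subst (Eq _) same (class x)) (ϖ-sym _ _ (class y))
  ; to-surj = λ (y , ŷ) → (y , ρ̂₀⇒ρ₀ y ŷ) , unique _ y (chosen _) ŷ (ϖ-sym _ _ (class _))
  ; to-rel  = λ s u → ρ-compat s (proj₁ ∘ u) (proj₁ ∘ representative ∘ u) (class ∘ u)
  }
  where
  open GScheme I
  open WellDefinedOn wd
  open IsTransversal T
  Dom = Σ (Vec (Carrier A) p) λ x → ⟦ ρ₀ ⟧ A (lookup x)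

  representative : Dom → Σ (Vec (Carrier A) p) λ y → ⟦ ρ̂₀ ⟧ A (lookup y)
  representative (x , x∈) = let y , ŷ , _ = meets x x∈ in y , ŷ

  chosen : ∀ x → ⟦ ρ̂₀ ⟧ A (lookup (proj₁ (representative x)))
  chosen x = proj₂ (representative x)

  class : ∀ x → Eq (proj₁ x) (proj₁ (representative x))
  class (x , x∈) = proj₂ (proj₂ (meets x x∈))

module _ {k ℓ : ℕ} {N : Fin k → ℕ} where

  _≟ᴮ_ : DecidableEquality (BDom k ℓ N)
  _≟ᴮ_ = ⊎ₚ.≡-dec Fin._≟_ (Σₚ.≡-dec Fin._≟_ Fin._≟_)

  Brel-dec : ∀ s u → Dec (Brel {k} {ℓ} N s u)
  Brel-dec (UE e) u = u zero ≟ᴮ inj₁ e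
  Brel-dec (UT i) u with u zero
  ... | inj₁ _       = no λ { (_ , ()) }
  ... | inj₂ (j , a) = map′ (λ { refl → a , refl }) (λ { (_ , refl) → refl }) (j Fin.≟ i)
  Brel-dec (S i) u with u zero | u (suc zero)
  ... | inj₁ _       | _             = no λ { (_ , _ , () , _) }
  ... | inj₂ _       | inj₁ _        = no λ { (_ , _ , _ , () , _) }
  ... | inj₂ (j , a) | inj₂ (j' , b) with j Fin.≟ i | j' Fin.≟ i
  ...   | no j≢i   | _         = no λ { (_ , _ , refl , _) → j≢i refl }
  ...   | yes _    | no j'≢i   = no λ { (_ , _ , _ , refl , _) → j'≢i refl }
  ...   | yes refl | yes refl  =
    map′ (λ a<b → a , b , refl , refl , a<b) (λ { (_ , _ , refl , refl , a<b) → a<b }) (a Fin.<? b)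

  Brel-cong : ∀ s {u v : Fin (βar s) → BDom k ℓ N} → (∀ j → u j ≡ v j) →
              Brel N s u → Brel N s v
  Brel-cong (UE e) u≗v u∈         = trans (sym (u≗v zero)) u∈
  Brel-cong (UT i) u≗v (a , u₀≡)  = a , trans (sym (u≗v zero)) u₀≡
  Brel-cong (S i)  u≗v (a , b , u₀≡ , u₁≡ , a<b) =
    a , b , trans (sym (u≗v zero)) u₀≡ , trans (sym (u≗v (suc zero))) u₁≡ , a<b

  Brel-≗ : ∀ s {u v : Fin (βar s) → BDom k ℓ N} → (∀ j → u j ≡ v j) →
           Brel N s u ⇔ Brel N s v
  Brel-≗ s u≗v = mk⇔ (Brel-cong s u≗v) (Brel-cong s (sym ∘ u≗v))

  position-injective : ∀ {i} {a b : Fin (N i)} →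
                       _≡_ {A = BDom k ℓ N} (inj₂ (i , a)) (inj₂ (i , b)) → a ≡ b
  position-injective refl = refl

  𝔹-id : Embedding (𝔹 k ℓ N) (𝔹 k ℓ N)
  𝔹-id = record { embed = id ; injective = id ; rel-⇔ = Brel-≗ }

  ⟦⟧-cong : (φ : QF (β k ℓ) V) {a b : V → BDom k ℓ N} →
            (∀ x → a x ≡ b x) → ⟦ φ ⟧ (𝔹 k ℓ N) a ⇔ ⟦ φ ⟧ (𝔹 k ℓ N) b
  ⟦⟧-cong = embedding-⇔ 𝔹-id

  𝔹-dec : (φ : QF (β k ℓ) V) (a : V → BDom k ℓ N) → Dec (⟦ φ ⟧ (𝔹 k ℓ N) a)
  𝔹-dec = ⟦⟧-dec _≟ᴮ_ Brel-dec

-- A term inj₂ e of V ⊎ Fin ℓ is a constant naming the point of the e-th copy of E;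
-- elimE removes such constants using the relations U^E_e.
module _ {k ℓ : ℕ} {V : Set} where

  withE : ∀ {N} → (V → BDom k ℓ N) → V ⊎ Fin ℓ → BDom k ℓ N
  withE a = [ a , inj₁ ]

  private
    isE : Fin ℓ → V ⊎ Fin ℓ → QF (β k ℓ) V
    isE e (inj₁ x)  = R (UE e) (λ _ → x)
    isE e (inj₂ e') = ⌜ e' Fin.≟ e ⌝

    eqTerm : V ⊎ Fin ℓ → V ⊎ Fin ℓ → QF (β k ℓ) V
    eqTerm (inj₁ x) (inj₁ y) = x ≐ y
    eqTerm (inj₁ x) (inj₂ e) = isE e (inj₁ x)
    eqTerm (inj₂ e) t        = isE e t

    inT : Fin k → V ⊎ Fin ℓ → QF (β k ℓ) V
    inT i (inj₁ x) = R (UT i) (λ _ → x)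
    inT i (inj₂ _) = false

    lessT : Fin k → V ⊎ Fin ℓ → V ⊎ Fin ℓ → QF (β k ℓ) V
    lessT i (inj₁ x) (inj₁ y) = R (S i) (lookup (x ∷ y ∷ []))
    lessT i _        _        = false

  elimE : QF (β k ℓ) (V ⊎ Fin ℓ) → QF (β k ℓ) V
  elimE true            = true
  elimE false           = false
  elimE (t ≐ t')        = eqTerm t t'
  elimE (R (UE e) ts)   = isE e (ts zero)
  elimE (R (UT i) ts)   = inT i (ts zero)
  elimE (R (S i) ts)    = lessT i (ts zero) (ts (suc zero))
  elimE (¬' φ)          = ¬' elimE φ
  elimE (φ ∧' ψ)        = elimE φ ∧' elimE ψ
  elimE (φ ∨' ψ)        = elimE φ ∨' elimE ψ

  module _ {N : Fin k → ℕ} {a : V → BDom k ℓ N} where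
    private
      𝐁 = 𝔹 k ℓ N

      isE-⇔ : ∀ e t → ⟦ isE e t ⟧ 𝐁 a ⇔ withE a t ≡ inj₁ e
      isE-⇔ e (inj₁ x)  = ⇔-refl
      isE-⇔ e (inj₂ e') = ⇔-trans (⌜⌝-⇔ (e' Fin.≟ e)) (mk⇔ (cong inj₁) ⊎ₚ.inj₁-injective)

      eqTerm-⇔ : ∀ t t' → ⟦ eqTerm t t' ⟧ 𝐁 a ⇔ withE a t ≡ withE a t'
      eqTerm-⇔ (inj₁ x) (inj₁ y) = ⇔-refl
      eqTerm-⇔ (inj₁ x) (inj₂ e) = isE-⇔ e (inj₁ x)
      eqTerm-⇔ (inj₂ e) t        = ⇔-trans (isE-⇔ e t) (mk⇔ sym sym)

      inT-⇔ : ∀ i t → ⟦ inT i t ⟧ 𝐁 a ⇔ Brel N (UT i) (λ _ → withE a t)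
      inT-⇔ i (inj₁ x) = ⇔-refl
      inT-⇔ i (inj₂ e) = mk⇔ (λ ()) (λ { (_ , ()) })

      lessT-⇔ : ∀ i t t' → ⟦ lessT i t t' ⟧ 𝐁 a ⇔ Brel N (S i) (lookup (withE a t ∷ withE a t' ∷ []))
      lessT-⇔ i (inj₁ x) (inj₁ y) = ⇔-refl
      lessT-⇔ i (inj₁ x) (inj₂ e) = mk⇔ (λ ()) (λ { (_ , _ , _ , () , _) })
      lessT-⇔ i (inj₂ e) t'       = mk⇔ (λ ()) (λ { (_ , _ , () , _) })

    elimE-⇔ : ∀ φ → ⟦ elimE φ ⟧ 𝐁 a ⇔ ⟦ φ ⟧ 𝐁 (withE a)
    elimE-⇔ true          = ⇔-refl
    elimE-⇔ false         = ⇔-refl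
    elimE-⇔ (t ≐ t')      = eqTerm-⇔ t t'
    elimE-⇔ (R (UE e) ts) = isE-⇔ e (ts zero)
    elimE-⇔ (R (UT i) ts) = inT-⇔ i (ts zero)
    elimE-⇔ (R (S i) ts)  = lessT-⇔ i (ts zero) (ts (suc zero))
    elimE-⇔ (¬' φ)        = ¬-cong-⇔ (elimE-⇔ φ)
    elimE-⇔ (φ ∧' ψ)      = elimE-⇔ φ ×-⇔ elimE-⇔ ψ
    elimE-⇔ (φ ∨' ψ)      = elimE-⇔ φ ⊎-⇔ elimE-⇔ ψ

module _ {k ℓ : ℕ} {N : Fin k → ℕ} where
  private
    D = BDom k ℓ N

  tag : D → Fin ℓ ⊎ Fin k
  tag (inj₁ e)       = inj₁ e
  tag (inj₂ (i , _)) = inj₂ i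

  block : D → Fin (ℓ + k)
  block = join ℓ k ∘ tag

  _≺_ : D → D → Set
  x ≺ y = block x < block y ⊎ Σ (Fin k) λ i → Brel N (S i) (lookup (x ∷ y ∷ []))

  ≺-wellFounded : WellFounded _≺_
  ≺-wellFounded = WF.Subrelation.wellFounded ≺⇒key<
    (On.wellFounded key (×-wellFounded Finᵢ.<-wellFounded ℕᵢ.<-wellFounded))
    where
    key : D → Fin (ℓ + k) × ℕ
    key x = block x , [ (λ _ → 0) , (λ (_ , a) → toℕ a) ] x

    ≺⇒key< : ∀ {x y} → x ≺ y → ×-Lex _≡_ _<_ ℕ._<_ (key x) (key y)
    ≺⇒key< (inj₁ lt)                           = inj₁ lt
    ≺⇒key< (inj₂ (_ , _ , _ , refl , refl , a<b)) = inj₂ (refl , a<b)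

  ≺-total : ∀ x y → x ≡ y ⊎ x ≺ y ⊎ y ≺ x
  ≺-total x y with Finₚ.<-cmp (block x) (block y)
  ... | tri< lt _ _ = inj₂ (inj₁ (inj₁ lt))
  ... | tri> _ _ gt = inj₂ (inj₂ (inj₁ gt))
  ... | tri≈ _ eq _ = sameTag x y (begin
    tag x                      ≡⟨ Finₚ.splitAt-join ℓ k (tag x) ⟨
    Fin.splitAt ℓ (block x)    ≡⟨ cong (Fin.splitAt ℓ) eq ⟩
    Fin.splitAt ℓ (block y)    ≡⟨ Finₚ.splitAt-join ℓ k (tag y) ⟩
    tag y                      ∎)
    where
    open ≡-Reasoning
    sameTag : ∀ x y → tag x ≡ tag y → x ≡ y ⊎ x ≺ y ⊎ y ≺ x
    sameTag (inj₁ e)       (inj₁ .e)       refl = inj₁ refl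
    sameTag (inj₁ _)       (inj₂ _)        ()
    sameTag (inj₂ _)       (inj₁ _)        ()
    sameTag (inj₂ (i , a)) (inj₂ (.i , b)) refl with Finₚ.<-cmp a b
    ... | tri< a<b _ _  = inj₂ (inj₁ (inj₂ (i , a , b , refl , refl , a<b)))
    ... | tri≈ _ refl _ = inj₁ refl
    ... | tri> _ _ b<a  = inj₂ (inj₂ (inj₂ (i , b , a , refl , refl , b<a)))

  _<ₗ_ : ∀ {n} → Vec D n → Vec D n → Set
  _<ₗ_ = Lex-< _≡_ _≺_

  <ₗ-wellFounded : ∀ {n} → WellFounded (_<ₗ_ {n})
  <ₗ-wellFounded = <-wellFounded trans (λ { refl x≺y → x≺y }) ≺-wellFounded

  <ₗ-total : ∀ {n} (xs ys : Vec D n) → xs ≡ ys ⊎ xs <ₗ ys ⊎ ys <ₗ xs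
  <ₗ-total []       []       = inj₁ refl
  <ₗ-total (x ∷ xs) (y ∷ ys) with ≺-total x y
  ... | inj₂ (inj₁ x≺y) = inj₂ (inj₁ (this x≺y refl))
  ... | inj₂ (inj₂ y≺x) = inj₂ (inj₂ (this y≺x refl))
  ... | inj₁ refl with <ₗ-total xs ys
  ...   | inj₁ refl         = inj₁ refl
  ...   | inj₂ (inj₁ xs<ys) = inj₂ (inj₁ (next refl xs<ys))
  ...   | inj₂ (inj₂ ys<xs) = inj₂ (inj₂ (next refl ys<xs))

module _ {k ℓ : ℕ} {V : Set} where

  hasTag : Fin ℓ ⊎ Fin k → V → QF (β k ℓ) V
  hasTag (inj₁ e) x = R (UE e) (λ _ → x)
  hasTag (inj₂ i) x = R (UT i) (λ _ → x)

  private
    tags : Enumeration (Fin ℓ ⊎ Fin k)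
    tags = finite ℓ ⊎ᵉ finite k

    taggedBelow : V → V → Fin ℓ ⊎ Fin k → Fin ℓ ⊎ Fin k → QF (β k ℓ) V
    taggedBelow x y t t' = ⌜ join ℓ k t Fin.<? join ℓ k t' ⌝ ∧' (hasTag t x ∧' hasTag t' y)

  blockOrder : V → V → QF (β k ℓ) V
  blockOrder x y = ⋁ (elements tags) λ t → ⋁ (elements tags) (taggedBelow x y t)

  infix 30 _≺ᶠ_
  _≺ᶠ_ : V → V → QF (β k ℓ) V
  x ≺ᶠ y = blockOrder x y ∨' ⋁ (elements (finite k)) (λ i → R (S i) (lookup (x ∷ y ∷ [])))

  lexᶠ : ∀ {n} → Vec V n → Vec V n → QF (β k ℓ) V
  lexᶠ []       []       = false
  lexᶠ (x ∷ xs) (y ∷ ys) = x ≺ᶠ y ∨' ((x ≐ y) ∧' lexᶠ xs ys)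

  module _ {N : Fin k → ℕ} {a : V → BDom k ℓ N} where
    private
      𝐁 = 𝔹 k ℓ N

    hasTag-⇔ : ∀ t x → ⟦ hasTag t x ⟧ 𝐁 a ⇔ tag (a x) ≡ t
    hasTag-⇔ (inj₁ e) x = tagE (a x)
      where
      tagE : ∀ (w : BDom k ℓ N) → w ≡ inj₁ e ⇔ tag w ≡ inj₁ e
      tagE (inj₁ e') = mk⇔ (cong inj₁ ∘ ⊎ₚ.inj₁-injective) (cong inj₁ ∘ ⊎ₚ.inj₁-injective)
      tagE (inj₂ _)  = mk⇔ (λ ()) (λ ())
    hasTag-⇔ (inj₂ i) x = tagT (a x)
      where
      tagT : ∀ (w : BDom k ℓ N) → Σ (Fin (N i)) (λ b → w ≡ inj₂ (i , b)) ⇔ tag w ≡ inj₂ i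
      tagT (inj₁ _)       = mk⇔ (λ { (_ , ()) }) (λ ())
      tagT (inj₂ (j , b)) = mk⇔ (λ { (_ , refl) → refl }) (λ { refl → b , refl })

    blockOrder-⇔ : ∀ x y → ⟦ blockOrder x y ⟧ 𝐁 a ⇔ block (a x) < block (a y)
    blockOrder-⇔ x y = mk⇔
      (λ h → let t , h′ = to (⋁-⇔ tags (λ t → ⋁ (elements tags) (taggedBelow x y t))) h
                 t′ , lt , tx , ty = to (⋁-⇔ tags (taggedBelow x y t)) h′
             in subst₂ _<_ (cong (join ℓ k) (sym (to (hasTag-⇔ t x) tx)))
                           (cong (join ℓ k) (sym (to (hasTag-⇔ t′ y) ty)))
                           (to (⌜⌝-⇔ (join ℓ k t Fin.<? join ℓ k t′)) lt))
      (λ lt → from (⋁-⇔ tags (λ t → ⋁ (elements tags) (taggedBelow x y t)))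
                (tag (a x) , from (⋁-⇔ tags (taggedBelow x y (tag (a x)))) (tag (a y) ,
                from (⌜⌝-⇔ (block (a x) Fin.<? block (a y))) lt ,
                from (hasTag-⇔ _ x) refl , from (hasTag-⇔ _ y) refl)))

    ≺ᶠ-⇔ : ∀ x y → ⟦ x ≺ᶠ y ⟧ 𝐁 a ⇔ a x ≺ a y
    ≺ᶠ-⇔ x y = blockOrder-⇔ x y ⊎-⇔ ⋁-⇔ (finite k) _

    lexᶠ-⇔ : ∀ {n} (xs ys : Vec V n) → ⟦ lexᶠ xs ys ⟧ 𝐁 a ⇔ map a xs <ₗ map a ys
    lexᶠ-⇔ []       []       = P⇔[]<[]
    lexᶠ-⇔ (x ∷ xs) (y ∷ ys) = ⇔-trans (≺ᶠ-⇔ x y ⊎-⇔ (⇔-refl ×-⇔ lexᶠ-⇔ xs ys)) ∷<∷-⇔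

module _ {m n : ℕ} {h : Fin m → Fin n} (h-mono : ∀ {a b} → a < b → h a < h b) where

  strictMono-injective : Injective _≡_ _≡_ h
  strictMono-injective {a} {b} ha≡hb with Finₚ.<-cmp a b
  ... | tri< a<b _ _ = ⊥-elim (Finₚ.<-irrefl ha≡hb (h-mono a<b))
  ... | tri≈ _ a≡b _ = a≡b
  ... | tri> _ _ b<a = ⊥-elim (Finₚ.<-irrefl (sym ha≡hb) (h-mono b<a))

  strictMono-reflects-< : ∀ {a b} → h a < h b → a < b
  strictMono-reflects-< {a} {b} ha<hb with Finₚ.<-cmp a b
  ... | tri< a<b _ _    = a<b
  ... | tri≈ _ refl _   = ⊥-elim (Finₚ.<-irrefl refl ha<hb)
  ... | tri> _ _ b<a    = ⊥-elim (Finₚ.<-asym ha<hb (h-mono b<a))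

module _ {k ℓ : ℕ} {N N' : Fin k → ℕ} (g : ∀ i → Fin (N i) → Fin (N' i)) where

  mapTournaments : BDom k ℓ N → BDom k ℓ N'
  mapTournaments (inj₁ e)       = inj₁ e
  mapTournaments (inj₂ (i , a)) = inj₂ (i , g i a)

  module _ (g-mono : ∀ i {a b} → a < b → g i a < g i b) where
    private
      injective′ : Injective _≡_ _≡_ mapTournaments
      injective′ {inj₁ _}       {inj₁ _}       refl = refl
      injective′ {inj₁ _}       {inj₂ _}       ()
      injective′ {inj₂ _}       {inj₁ _}       ()
      injective′ {inj₂ (i , a)} {inj₂ (j , b)} ga≡gb with refl ← cong tag ga≡gb =
        cong (λ c → inj₂ (i , c)) (strictMono-injective (g-mono i) (position-injective ga≡gb))

      UE-⇔ : ∀ e w → w ≡ inj₁ e ⇔ mapTournaments w ≡ inj₁ e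
      UE-⇔ e (inj₁ _) = mk⇔ (cong inj₁ ∘ ⊎ₚ.inj₁-injective) (cong inj₁ ∘ ⊎ₚ.inj₁-injective)
      UE-⇔ e (inj₂ _) = mk⇔ (λ ()) (λ ())

      UT-⇔ : ∀ i w → Σ (Fin (N i)) (λ a → w ≡ inj₂ (i , a))
                   ⇔ Σ (Fin (N' i)) (λ a → mapTournaments w ≡ inj₂ (i , a))
      UT-⇔ i (inj₁ _)       = mk⇔ (λ { (_ , ()) }) (λ { (_ , ()) })
      UT-⇔ i (inj₂ (j , a)) = mk⇔ (λ { (_ , refl) → g i a , refl }) (λ { (_ , refl) → a , refl })

      S-⇔ : ∀ i w w′ → Brel N (S i) (lookup (w ∷ w′ ∷ []))
                     ⇔ Brel N' (S i) (lookup (mapTournaments w ∷ mapTournaments w′ ∷ []))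
      S-⇔ i (inj₁ _)       _              = mk⇔ (λ { (_ , _ , () , _) }) (λ { (_ , _ , () , _) })
      S-⇔ i (inj₂ _)       (inj₁ _)       = mk⇔ (λ { (_ , _ , _ , () , _) }) (λ { (_ , _ , _ , () , _) })
      S-⇔ i (inj₂ (j , a)) (inj₂ (j′ , b)) = mk⇔
        (λ { (_ , _ , refl , refl , a<b) → g i a , g i b , refl , refl , g-mono i a<b })
        (λ { (_ , _ , refl , refl , ga<gb) → a , b , refl , refl , strictMono-reflects-< (g-mono i) ga<gb })

      rel-⇔′ : ∀ s u → Brel N s u ⇔ Brel N' s (mapTournaments ∘ u)
      rel-⇔′ (UE e) u = UE-⇔ e (u zero)
      rel-⇔′ (UT i) u = UT-⇔ i (u zero)
      rel-⇔′ (S i)  u = S-⇔ i (u zero) (u (suc zero))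

    monotoneEmbedding : Embedding (𝔹 k ℓ N) (𝔹 k ℓ N')
    monotoneEmbedding = record
      { embed     = mapTournaments
      ; injective = injective′
      ; rel-⇔     = λ s {u} fu≗v → ⇔-trans (rel-⇔′ s u) (Brel-≗ s fu≗v)
      }

stretch : ∀ {k} → ℕ → (Fin k → ℕ) → Fin k → ℕ
stretch M N i = N i * suc M

module _ {k ℓ : ℕ} {N : Fin k → ℕ} (M : ℕ) where

  -- The point a of T_{N i} goes to the point (M + 1) a + r a of T_{(M + 1) N i}.
  spread : (BDom k ℓ N → Fin (suc M)) → Embedding (𝔹 k ℓ N) (𝔹 k ℓ (stretch M N))
  spread r = monotoneEmbedding (λ i a → combine a (r (inj₂ (i , a))))
                               (λ i a<b → Finₚ.combine-monoˡ-< _ _ a<b)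

  spread-agree : ∀ r r′ w → r w ≡ r′ w → embed (spread r) w ≡ embed (spread r′) w
  spread-agree r r′ (inj₁ _)       _     = refl
  spread-agree r r′ (inj₂ (i , a)) rw≡r′w = cong (λ s → inj₂ (i , combine a s)) rw≡r′w

  spread-separates : ∀ r r′ z → embed (spread r) (inj₂ z) ≡ embed (spread r′) (inj₂ z) →
                     r (inj₂ z) ≡ r′ (inj₂ z)
  spread-separates r r′ (i , a) eq =
    Finₚ.combine-injectiveʳ a (r (inj₂ (i , a))) a (r′ (inj₂ (i , a))) (position-injective eq)

module _ {k ℓ : ℕ} {λ' : Sig} (I : GScheme (β k ℓ) λ') (M : ℕ)
         (bounded : ∀ N v → ClassSizeAtMost I (𝔹 k ℓ N) M v) where
  open GScheme I

  ϖ-tournament-coordinate : ∀ {N} {x y : Vec (BDom k ℓ N) p} {c z} →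
    ⟦ ϖ ⟧ (𝔹 k ℓ N) (pairAssign x y) → lookup y c ≡ inj₂ z → ∃ λ d → lookup x d ≡ inj₂ z
  ϖ-tournament-coordinate {N} {x} {y} {c} {z} x∼y yc≡z
    with Finₚ.any? (λ d → lookup x d ≟ᴮ inj₂ z)
  ... | yes z∈x = z∈x
  ... | no  z∉x = ⊥-elim (bounded (stretch M N) (map (embed (lift zero)) x)
                                  (copy , copy-injective , copy-∼))
    where
    z̄ : BDom k ℓ N
    z̄ = inj₂ z

    slot : Fin (suc M) → BDom k ℓ N → Fin (suc M)
    slot j w = if does (w ≟ᴮ z̄) then j else zero

    slot-z : ∀ j → slot j z̄ ≡ j
    slot-z j = cong (if_then j else zero) (dec-true (z̄ ≟ᴮ z̄) refl)

    slot-x : ∀ j d → slot j (lookup x d) ≡ zero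
    slot-x j d = cong (if_then j else zero) (dec-false (lookup x d ≟ᴮ z̄) (λ xd≡z → z∉x (d , xd≡z)))

    -- Every lift j agrees with lift zero on x and sends z̄ to slot j.
    lift : Fin (suc M) → Embedding (𝔹 k ℓ N) (𝔹 k ℓ (stretch M N))
    lift j = spread M (slot j)

    copy : Fin (suc M) → Vec (BDom k ℓ (stretch M N)) p
    copy j = map (embed (lift j)) y

    copy-injective : Injective _≡_ _≡_ copy
    copy-injective {j} {j′} copyj≡copyj′ = begin
      j             ≡⟨ slot-z j ⟨
      slot j z̄      ≡⟨ spread-separates M (slot j) (slot j′) z (begin
        embed (lift j) z̄               ≡⟨ cong (embed (lift j)) yc≡z ⟨
        embed (lift j) (lookup y c)    ≡⟨ lookup-map c _ y ⟨
        lookup (copy j) c              ≡⟨ cong (λ v → lookup v c) copyj≡copyj′ ⟩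
        lookup (copy j′) c             ≡⟨ lookup-map c _ y ⟩
        embed (lift j′) (lookup y c)   ≡⟨ cong (embed (lift j′)) yc≡z ⟩
        embed (lift j′) z̄              ∎) ⟩
      slot j′ z̄     ≡⟨ slot-z j′ ⟩
      j′            ∎
      where open ≡-Reasoning

    copy-∼ : ∀ j → ⟦ ϖ ⟧ (𝔹 k ℓ (stretch M N)) (pairAssign (map (embed (lift zero)) x) (copy j))
    copy-∼ j = to (embedding-⇔ (lift j) ϖ lifted) x∼y
      where
      lifted : ∀ v → embed (lift j) (pairAssign x y v) ≡
                     pairAssign (map (embed (lift zero)) x) (copy j) v
      lifted (zero , d)  =
        trans (spread-agree M (slot j) (slot zero) (lookup x d) (trans (slot-x j d) (sym (slot-x zero d))))
              (sym (lookup-map d _ x))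
      lifted (suc _ , d) = sym (lookup-map d _ y)

  ϖ-coordinates : ∀ {N} {x y : Vec (BDom k ℓ N) p} → ⟦ ϖ ⟧ (𝔹 k ℓ N) (pairAssign x y) →
                  ∀ c → ∃ λ t → withE (lookup x) t ≡ lookup y c
  ϖ-coordinates {y = y} x∼y c with lookup y c in yc≡
  ... | inj₁ e = inj₂ e , refl
  ... | inj₂ z = let d , xd≡z = ϖ-tournament-coordinate x∼y yc≡ in inj₁ d , xd≡z

module Canonical {k ℓ : ℕ} {λ' : Sig} (I : GScheme (β k ℓ) λ') (M : ℕ)
                 (bounded : ∀ N v → ClassSizeAtMost I (𝔹 k ℓ N) M v) where
  open GScheme I

  Term : Set
  Term = Fin p ⊎ Fin ℓ

  private
    pairShape : Vec Term p → Fin 2 × Fin p → Term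
    pairShape v (zero , c)  = inj₁ c
    pairShape v (suc _ , c) = lookup v c

    shapes : Enumeration (Vec Term p)
    shapes = vecᵉ (finite p ⊎ᵉ finite ℓ) p

  -- Evaluated at x, the shape v denotes the tuple with coordinates lookup v c, and
  -- tabulate inj₁ denotes x itself.
  smallerEquivalent : Vec Term p → QF (β k ℓ) Term
  smallerEquivalent v = rename (lookup v) ρ₀ ∧' (rename (pairShape v) ϖ ∧' lexᶠ v (tabulate inj₁))

  reducible : QF (β k ℓ) (Fin p)
  reducible = ⋁ (elements shapes) (elimE ∘ smallerEquivalent)

  ρ̂₀ : QF (β k ℓ) (Fin p)
  ρ̂₀ = ρ₀ ∧' (¬' reducible)

  module _ {N : Fin k → ℕ} where
    private
      D = BDom k ℓ N
      𝐁 = 𝔹 k ℓ N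

    _∼_ : Vec D p → Vec D p → Set
    x ∼ y = ⟦ ϖ ⟧ 𝐁 (pairAssign x y)

    instantiate : Vec D p → Vec Term p → Vec D p
    instantiate x v = map (withE (lookup x)) v

    SmallerEquivalent : Vec D p → Vec D p → Set
    SmallerEquivalent x y = ⟦ ρ₀ ⟧ 𝐁 (lookup y) × x ∼ y × y <ₗ x

    smallerEquivalent-⇔ : ∀ x v → ⟦ elimE (smallerEquivalent v) ⟧ 𝐁 (lookup x) ⇔
                                  SmallerEquivalent x (instantiate x v)
    smallerEquivalent-⇔ x v = ⇔-trans (elimE-⇔ (smallerEquivalent v))
      (   ⇔-trans (rename-⇔ (lookup v) ρ₀) (⟦⟧-cong ρ₀ (λ c → sym (lookup-map c _ v)))
      ×-⇔ ⇔-trans (rename-⇔ (pairShape v) ϖ) (⟦⟧-cong ϖ pairs)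
      ×-⇔ ⇔-trans (lexᶠ-⇔ v (tabulate inj₁))
                  (mk⇔ (subst (instantiate x v <ₗ_) map-vars) (subst (instantiate x v <ₗ_) (sym map-vars))))
      where
      pairs : ∀ u → withE (lookup x) (pairShape v u) ≡ pairAssign x (instantiate x v) u
      pairs (zero , c)  = refl
      pairs (suc _ , c) = sym (lookup-map c _ v)

      map-vars : map (withE (lookup x)) (tabulate inj₁) ≡ x
      map-vars = trans (sym (tabulate-∘ _ inj₁)) (tabulate∘lookup x)

    reducible-⇔ : ∀ x → ⟦ reducible ⟧ 𝐁 (lookup x) ⇔ ∃ λ v → SmallerEquivalent x (instantiate x v)
    reducible-⇔ x = ⇔-trans (⋁-⇔ shapes (elimE ∘ smallerEquivalent))
      (mk⇔ (λ (v , h) → v , to (smallerEquivalent-⇔ x v) h)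
           (λ (v , h) → v , from (smallerEquivalent-⇔ x v) h))

    ∼-instance : ∀ {x y} → x ∼ y → ∃ λ v → instantiate x v ≡ y
    ∼-instance {x} {y} x∼y = tabulate term , (begin
      map (withE (lookup x)) (tabulate term) ≡⟨ tabulate-∘ _ term ⟨
      tabulate (withE (lookup x) ∘ term)     ≡⟨ tabulate-cong (proj₂ ∘ ϖ-coordinates I M bounded x∼y) ⟩
      tabulate (lookup y)                    ≡⟨ tabulate∘lookup y ⟩
      y                                      ∎)
      where
      open ≡-Reasoning
      term : Fin p → Term
      term = proj₁ ∘ ϖ-coordinates I M bounded x∼y

    ρ̂₀-minimal : ∀ {x y} → ⟦ ρ̂₀ ⟧ 𝐁 (lookup x) → ¬ SmallerEquivalent x y
    ρ̂₀-minimal {x} (_ , irreducible) y-smaller@(_ , x∼y , _) with v , refl ← ∼-instance x∼y =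
      irreducible (from (reducible-⇔ x) (v , y-smaller))

    isTransversal : WellDefinedOn I 𝐁 → IsTransversal I 𝐁 ρ̂₀
    isTransversal wd = record
      { ρ̂₀⇒ρ₀  = λ _ → proj₁
      ; meets  = λ x → descend x (<ₗ-wellFounded x)
      ; unique = unique
      }
      where
      open WellDefinedOn wd

      descend : ∀ x → Acc _<ₗ_ x → ⟦ ρ₀ ⟧ 𝐁 (lookup x) → ∃ λ y → ⟦ ρ̂₀ ⟧ 𝐁 (lookup y) × x ∼ y
      descend x (acc smaller) x∈ with 𝔹-dec reducible (lookup x)
      ... | no irreducible = x , (x∈ , irreducible) , ϖ-refl x
      ... | yes r =
        let v , y∈ , x∼y , y<x = to (reducible-⇔ x) r
            z , ẑ , y∼z = descend _ (smaller y<x) y∈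
        in z , ẑ , ϖ-trans _ _ _ x∼y y∼z

      unique : ∀ x y → ⟦ ρ̂₀ ⟧ 𝐁 (lookup x) → ⟦ ρ̂₀ ⟧ 𝐁 (lookup y) → x ∼ y → x ≡ y
      unique x y x̂ ŷ x∼y with <ₗ-total x y
      ... | inj₁ x≡y         = x≡y
      ... | inj₂ (inj₁ x<y)  = ⊥-elim (ρ̂₀-minimal ŷ (proj₁ x̂ , ϖ-sym x y x∼y , x<y))
      ... | inj₂ (inj₂ y<x)  = ⊥-elim (ρ̂₀-minimal x̂ (proj₁ ŷ , x∼y , y<x))

theorem8p2 : (k ℓ q : ℕ) (a : Fin q → ℕ) (I : GScheme (β k ℓ) (finSig q a)) →
    (∀ N → WellDefinedOn I (𝔹 k ℓ N)) →
    Σ ℕ (λ M → ∀ N (v : Vec (BDom k ℓ N) (GScheme.p I)) → ClassSizeAtMost I (𝔹 k ℓ N) M v) →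
    Σ (QF (β k ℓ) (Fin (GScheme.p I))) (λ ρ̂₀ →
      ∀ N → ⟦ I ⟧ᵍ (𝔹 k ℓ N) ≅ ⟦ withDomain I ρ̂₀ ⟧ˢ (𝔹 k ℓ N))
theorem8p2 k ℓ q a I wd (M , bounded) =
  ρ̂₀ , λ N → transversal-≅ (wd N) (isTransversal (wd N))
  where open Canonical I M bounded
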